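{- Let $V$ be a finite set and let $\mathcal{C}$ be a minimal set cover of $V$. From each set $C\in\mathcal{C}$ choose one loyal vertex of $C$ (an element of $V$ lying in $C$ and in no other member of $\mathcal{C}$). Let $S$ be the set of chosen vertices and $K=V\setminus S$. Let $G$ be the graph with vertex set $V$ in which distinct $u,v$ are adjacent if and only if either $u$ and $v$ lie together in some member of $\mathcal{C}$, or $u,v\in K$. Then $G$ is a split graph, and $G$ is an unbalanced split graph if and only if $\mathcal{C}$ is an unbalanced minimal set cover (equivalently, $G$ is balanced if and only if $\mathcal{C}$ is balanced).
   Context: A set cover of a finite set $V$ is a collection $\mathcal{C}$ of subsets of $V$ whose union is $V$; it is minimal if no member of $\mathcal{C}$ is contained in the union of the remaining members. A minimal set cover $\mathcal{C}$ of $V$ is unbalanced if it contains a set of cardinality $|V|-|\mathcal{C}|+1$, and balanced otherwise. A finite graph $G$ is a split graph if its vertex set can be partitioned as $K\cup S$ with $K$ a clique and $S$ a stable set (a $KS$-partition). Writing $\omega(G)$ for the clique number and $\alpha(G)$ for the independence number, a split graph is balanced if it has a $KS$-partition with $|K|=\omega(G)$ and $|S|=\alpha(G)$, and unbalanced otherwise. -}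

module Defs where

open import Data.Nat using (ℕ; _+_; _∸_; _≤_)
open import Data.Fin using (Fin)
open import Data.Fin.Subset using (Subset; _∈_; _∉_; ∣_∣; ∁)
open import Data.Product using (Σ; ∃; _×_; _,_)
open import Data.Sum using (_⊎_)
open import Relation.Nullary using (¬_)
open import Relation.Binary.PropositionalEquality using (_≡_; _≢_)

-- A family 𝒞 of m subsets of V = Fin n, indexed by Fin m (|𝒞| = m).
Family : ℕ → ℕ → Set
Family n m = Fin m → Subset n

IsSetCover : ∀ {n m} → Family n m → Set
IsSetCover {n} {m} C = ∀ (v : Fin n) → ∃ λ (i : Fin m) → v ∈ C i

IsMinimalSetCover : ∀ {n m} → Family n m → Set
IsMinimalSetCover {n} {m} C =
  IsSetCover C ×
  (∀ (i : Fin m) → ¬ (∀ (v : Fin n) → v ∈ C i → ∃ λ (j : Fin m) → j ≢ i × v ∈ C j))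

UnbalancedCover : ∀ {n m} → Family n m → Set
UnbalancedCover {n} {m} C = ∃ λ (i : Fin m) → ∣ C i ∣ ≡ n ∸ m + 1

IsLoyal : ∀ {n m} → Family n m → Fin m → Fin n → Set
IsLoyal {n} {m} C i v = v ∈ C i × (∀ (j : Fin m) → j ≢ i → v ∉ C j)

Graph : ℕ → Set₁
Graph n = Fin n → Fin n → Set

-- the graph G of the theorem, built from 𝒞 and the choice ℓ of loyal vertices;
-- S = image of ℓ, K = V \ S
InS : ∀ {n m} → (Fin m → Fin n) → Fin n → Set
InS {n} {m} ℓ v = ∃ λ (i : Fin m) → ℓ i ≡ v

coverGraph : ∀ {n m} → Family n m → (Fin m → Fin n) → Graph n
coverGraph {n} {m} C ℓ u v =
  u ≢ v × ((∃ λ (i : Fin m) → u ∈ C i × v ∈ C i) ⊎ (¬ InS ℓ u × ¬ InS ℓ v))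

IsClique : ∀ {n} → Graph n → Subset n → Set
IsClique {n} G X = ∀ (u v : Fin n) → u ∈ X → v ∈ X → u ≢ v → G u v

IsStable : ∀ {n} → Graph n → Subset n → Set
IsStable {n} G X = ∀ (u v : Fin n) → u ∈ X → v ∈ X → ¬ G u v

IsCliqueNumber : ∀ {n} → Graph n → ℕ → Set
IsCliqueNumber G k =
  (∃ λ X → IsClique G X × ∣ X ∣ ≡ k) × (∀ X → IsClique G X → ∣ X ∣ ≤ k)

IsIndependenceNumber : ∀ {n} → Graph n → ℕ → Set
IsIndependenceNumber G k =
  (∃ λ X → IsStable G X × ∣ X ∣ ≡ k) × (∀ X → IsStable G X → ∣ X ∣ ≤ k)

IsKSPartition : ∀ {n} → Graph n → Subset n → Set
IsKSPartition G K = IsClique G K × IsStable G (∁ K)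

IsSplitGraph : ∀ {n} → Graph n → Set
IsSplitGraph G = ∃ λ K → IsKSPartition G K

BalancedSplit : ∀ {n} → Graph n → Set
BalancedSplit G = ∃ λ K →
  IsKSPartition G K × IsCliqueNumber G ∣ K ∣ × IsIndependenceNumber G ∣ ∁ K ∣

UnbalancedSplit : ∀ {n} → Graph n → Set
UnbalancedSplit G = IsSplitGraph G × ¬ BalancedSplit G

module Submission where

-- Write S for the set of chosen loyal vertices ℓ(i) and K = V ∖ S.  Any two
-- vertices of K are adjacent by construction, and two loyal vertices never lie
-- in a common member, so K is a clique and S a stable set: G is split.
-- Since ℓ is injective, |S| = m and |K| = n ∸ m.  The counting rests on one
-- general fact: a map injective on a subset A and landing in B gives |A| ≤ |B|.
--   * α(G) = m: in a stable set, distinct vertices lie in distinct members,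
--     so "the member containing v" is injective on it.
--   * Every member C i is a clique, and C i ∖ {ℓ i} ⊆ K, so |C i| ≤ |K| + 1.
--     A clique either avoids S (so lies in K) or contains some ℓ i and then
--     lies in C i.  Hence if no member has size |K| + 1 = n ∸ m + 1, ω = |K|
--     and (K, S) witnesses that G is balanced.
--   * In a balanced split graph any clique and stable set have at most n
--     vertices together; a member of size n ∸ m + 1 together with S has n + 1.

open import Defs
open import Data.Nat using (ℕ; zero; suc; _+_; _∸_; _≤_; z≤n; s≤s; s≤s⁻¹)
open import Data.Nat.Properties
open import Data.Fin using (Fin; zero; suc)
open import Data.Fin.Properties using (any?) renaming (_≟_ to _≟ᶠ_)
open import Data.Fin.Subset using (Subset; inside; outside; _∈_; _∉_; ∣_∣; ∁; _-_; _⊆_; ⊤)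
open import Data.Fin.Subset.Properties
open import Data.Vec.Base using (tabulate; _∷_; here; there)
open import Data.Vec.Properties using (lookup∘tabulate; lookup⇒[]=; []=⇒lookup)
open import Data.Bool.Base using (true)
open import Data.Product using (_×_; _,_; proj₁; proj₂; ∃)
open import Data.Sum using (_⊎_; inj₁; inj₂)
open import Function.Base using (_∘_)
open import Function.Bundles using (_⇔_; mk⇔)
open import Relation.Nullary using (¬_; Dec; yes; no; does; contradiction; ¬?)
open import Relation.Nullary.Decidable using (dec-true; decidable-stable; _×-dec_)
open import Relation.Unary using (Pred; Decidable)
open import Relation.Binary.PropositionalEquality
  using (_≡_; _≢_; refl; sym; trans; cong; cong₂; subst; module ≡-Reasoning)

⟦_⟧ : ∀ {n p} {P : Pred (Fin n) p} → Decidable P → Subset n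
⟦ P? ⟧ = tabulate (does ∘ P?)

∈⟦⟧⁺ : ∀ {n p} {P : Pred (Fin n) p} (P? : Decidable P) {x : Fin n} → P x → x ∈ ⟦ P? ⟧
∈⟦⟧⁺ P? {x} px = lookup⇒[]= x _ (trans (lookup∘tabulate _ x) (dec-true (P? x) px))

∈⟦⟧⁻ : ∀ {n p} {P : Pred (Fin n) p} (P? : Decidable P) {x : Fin n} → x ∈ ⟦ P? ⟧ → P x
∈⟦⟧⁻ P? {x} x∈ = witness (P? x) (trans (sym (lookup∘tabulate _ x)) ([]=⇒lookup x∈))
  where
  witness : ∀ {A : Set _} (a? : Dec A) → does a? ≡ true → A
  witness (yes a) _ = a

∣p∣+∣∁p∣≡n : ∀ {n} (p : Subset n) → ∣ p ∣ + ∣ ∁ p ∣ ≡ n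
∣p∣+∣∁p∣≡n p = trans (cong (∣ p ∣ +_) (∣∁p∣≡n∸∣p∣ p)) (m+[n∸m]≡n (∣p∣≤n p))

∣p∣≡1+∣p-x∣ : ∀ {n} (p : Subset n) (x : Fin n) → x ∈ p → ∣ p ∣ ≡ suc ∣ p - x ∣
∣p∣≡1+∣p-x∣ (inside ∷ p) zero here = cong suc (cong ∣_∣ (sym (p─⊥≡p p)))
∣p∣≡1+∣p-x∣ (inside ∷ p) (suc x) (there x∈p) = cong suc (∣p∣≡1+∣p-x∣ p x x∈p)
∣p∣≡1+∣p-x∣ (outside ∷ p) (suc x) (there x∈p) = ∣p∣≡1+∣p-x∣ p x x∈p

x∉p-x : ∀ {n} (p : Subset n) (x : Fin n) → x ∉ p - x
x∉p-x (_ ∷ p) (suc x) (there x∈p-x) = x∉p-x p x x∈p-x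

Embeds : ∀ {a b} → (Fin a → Fin b) → Subset a → Subset b → Set
Embeds f A B =
  (∀ {x} → x ∈ A → f x ∈ B) × (∀ {x y} → x ∈ A → y ∈ A → f x ≡ f y → x ≡ y)

embeds-remove : ∀ {a b} {f : Fin a → Fin b} {A B} {x} → x ∈ A →
  Embeds f A B → Embeds f (A - x) (B - f x)
embeds-remove {f = f} {A} {B} {x} x∈A (into , inj) = into′ , inj′
  where
  inj′ : ∀ {y z} → y ∈ A - x → z ∈ A - x → f y ≡ f z → y ≡ z
  inj′ y∈ z∈ = inj (p─q⊆p A _ y∈) (p─q⊆p A _ z∈)

  into′ : ∀ {y} → y ∈ A - x → f y ∈ B - f x
  into′ {y} y∈ = x∈p∧x≢y⇒x∈p-y (into (p─q⊆p A _ y∈)) λ fy≡fx →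
    x∉p-x A x (subst (_∈ A - x) (inj (p─q⊆p A _ y∈) x∈A fy≡fx) y∈)

embeds⇒∣A∣≤∣B∣ : ∀ {a b} {f : Fin a → Fin b} {A B} → Embeds f A B → ∣ A ∣ ≤ ∣ B ∣
embeds⇒∣A∣≤∣B∣ {A = A} emb = go _ A refl emb
  where
  go : ∀ {a b} {f : Fin a → Fin b} {B} k (A : Subset a) →
    ∣ A ∣ ≡ k → Embeds f A B → ∣ A ∣ ≤ ∣ B ∣
  go zero A ∣A∣≡0 _ = ≤-trans (≤-reflexive ∣A∣≡0) z≤n
  go {a} {f = f} {B} (suc k) A ∣A∣≡1+k emb with nonempty? A
  ... | no A-empty =
    contradiction (trans (sym ∣A∣≡1+k) (trans (cong ∣_∣ (Empty-unique A-empty)) (∣⊥∣≡0 a))) λ ()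
  ... | yes (x , x∈A) = begin
    ∣ A ∣            ≡⟨ ∣p∣≡1+∣p-x∣ A x x∈A ⟩
    suc ∣ A - x ∣    ≤⟨ s≤s (go k (A - x) ∣A-x∣≡k (embeds-remove x∈A emb)) ⟩
    suc ∣ B - f x ∣  ≤⟨ x∈p⇒∣p-x∣<∣p∣ (proj₁ emb x∈A) ⟩
    ∣ B ∣            ∎
    where
    open ≤-Reasoning
    ∣A-x∣≡k : ∣ A - x ∣ ≡ k
    ∣A-x∣≡k = suc-injective (trans (sym (∣p∣≡1+∣p-x∣ A x x∈A)) ∣A∣≡1+k)

-- In a balanced split graph a clique and a stable set have at most n vertices
-- together: they are bounded by the two sides of an optimal KS-partition.
balanced⇒∣X∣+∣Y∣≤n : ∀ {n} {G : Graph n} {X Y : Subset n} → BalancedSplit G →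
  IsClique G X → IsStable G Y → ∣ X ∣ + ∣ Y ∣ ≤ n
balanced⇒∣X∣+∣Y∣≤n {n} {X = X} {Y} (K , _ , (_ , ω-max) , (_ , α-max)) X-clique Y-stable =
  begin
    ∣ X ∣ + ∣ Y ∣    ≤⟨ +-mono-≤ (ω-max X X-clique) (α-max Y Y-stable) ⟩
    ∣ K ∣ + ∣ ∁ K ∣  ≡⟨ ∣p∣+∣∁p∣≡n K ⟩
    n                ∎
  where open ≤-Reasoning

-- The graph G of the theorem, for a set cover C with loyal vertices ℓ.
-- (Minimality of the cover is only needed for loyal vertices to exist.)
module CoverGraph {n m : ℕ} (C : Family n m) (cover : IsSetCover C)
  (ℓ : Fin m → Fin n) (loyal : ∀ (i : Fin m) → IsLoyal C i (ℓ i)) where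

  G : Graph n
  G = coverGraph C ℓ

  InS? : Decidable (InS ℓ)
  InS? v = any? (λ i → ℓ i ≟ᶠ v)

  K : Subset n
  K = ⟦ ¬? ∘ InS? ⟧

  S : Subset n
  S = ∁ K

  ∈K⁺ : ∀ {v} → ¬ InS ℓ v → v ∈ K
  ∈K⁺ = ∈⟦⟧⁺ (¬? ∘ InS?)

  ∈K⁻ : ∀ {v} → v ∈ K → ¬ InS ℓ v
  ∈K⁻ = ∈⟦⟧⁻ (¬? ∘ InS?)

  ∈S⁺ : ∀ {v} → InS ℓ v → v ∈ S
  ∈S⁺ chosen = x∉p⇒x∈∁p (λ v∈K → ∈K⁻ v∈K chosen)

  ∈S⁻ : ∀ {v} → v ∈ S → InS ℓ v
  ∈S⁻ {v} v∈S = decidable-stable (InS? v) (x∈∁p⇒x∉p v∈S ∘ ∈K⁺)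

  loyal-member : ∀ {i j} → ℓ i ∈ C j → j ≡ i
  loyal-member {i} {j} ℓi∈Cj with j ≟ᶠ i
  ... | yes j≡i = j≡i
  ... | no j≢i = contradiction ℓi∈Cj (proj₂ (loyal i) j j≢i)

  ℓ-injective : ∀ {i j} → ℓ i ≡ ℓ j → i ≡ j
  ℓ-injective {i} ℓi≡ℓj = loyal-member (subst (_∈ C i) ℓi≡ℓj (proj₁ (loyal i)))

  member-clique : ∀ i → IsClique G (C i)
  member-clique i u v u∈Ci v∈Ci u≢v = u≢v , inj₁ (i , u∈Ci , v∈Ci)

  K-clique : IsClique G K
  K-clique u v u∈K v∈K u≢v = u≢v , inj₂ (∈K⁻ u∈K , ∈K⁻ v∈K)

  S-stable : IsStable G S
  S-stable u v u∈S v∈S (u≢v , inj₁ (k , u∈Ck , v∈Ck)) with ∈S⁻ u∈S | ∈S⁻ v∈S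
  ... | i , refl | j , refl = u≢v (cong ℓ (trans (sym (loyal-member u∈Ck)) (loyal-member v∈Ck)))
  S-stable u v u∈S v∈S (_ , inj₂ (u∉S , _)) = u∉S (∈S⁻ u∈S)

  member : Fin n → Fin m
  member v = proj₁ (cover v)

  -- α(G) ≤ m: distinct vertices of a stable set lie in distinct members.
  stable-size : ∀ {X} → IsStable G X → ∣ X ∣ ≤ m
  stable-size {X} X-stable =
    subst (∣ X ∣ ≤_) (∣⊤∣≡n m) (embeds⇒∣A∣≤∣B∣ ((λ _ → ∈⊤) , member-injective))
    where
    member-injective : ∀ {x y} → x ∈ X → y ∈ X → member x ≡ member y → x ≡ y
    member-injective {x} {y} x∈X y∈X same with x ≟ᶠ y
    ... | yes x≡y = x≡y
    ... | no x≢y = contradiction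
      (member-clique (member x) x y (proj₂ (cover x))
        (subst (λ j → y ∈ C j) (sym same) (proj₂ (cover y))) x≢y)
      (X-stable x y x∈X y∈X)

  ∣S∣≡m : ∣ S ∣ ≡ m
  ∣S∣≡m = ≤-antisym (stable-size S-stable)
    (subst (_≤ ∣ S ∣) (∣⊤∣≡n m)
      (embeds⇒∣A∣≤∣B∣ {A = ⊤} ((λ {i} _ → ∈S⁺ (i , refl)) , λ _ _ → ℓ-injective)))

  m≤n : m ≤ n
  m≤n = subst (_≤ n) ∣S∣≡m (∣p∣≤n S)

  ∣K∣≡n∸m : ∣ K ∣ ≡ n ∸ m
  ∣K∣≡n∸m = begin
    ∣ K ∣                  ≡⟨ sym (m+n∸n≡m ∣ K ∣ ∣ S ∣) ⟩
    ∣ K ∣ + ∣ S ∣ ∸ ∣ S ∣  ≡⟨ cong₂ _∸_ (∣p∣+∣∁p∣≡n K) ∣S∣≡m ⟩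
    n ∸ m                  ∎
    where open ≡-Reasoning

  -- Apart from its own loyal vertex, a member consists of unchosen vertices.
  member-size : ∀ i → ∣ C i ∣ ≤ suc ∣ K ∣
  member-size i = begin
    ∣ C i ∣            ≡⟨ ∣p∣≡1+∣p-x∣ (C i) (ℓ i) (proj₁ (loyal i)) ⟩
    suc ∣ C i - ℓ i ∣  ≤⟨ s≤s (p⊆q⇒∣p∣≤∣q∣ Ci-ℓi⊆K) ⟩
    suc ∣ K ∣          ∎
    where
    open ≤-Reasoning
    Ci-ℓi⊆K : C i - ℓ i ⊆ K
    Ci-ℓi⊆K {u} u∈ = ∈K⁺ λ { (j , refl) →
      x∉p-x (C i) (ℓ i) (subst (λ k → ℓ k ∈ C i - ℓ i) (sym (loyal-member (p─q⊆p (C i) _ u∈))) u∈) }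

  -- A clique lies in K, or contains some ℓ i and then lies in C i
  -- (the neighbours of ℓ i are exactly the other vertices of C i).
  clique-shape : ∀ {X} → IsClique G X → X ⊆ K ⊎ ∃ λ i → X ⊆ C i
  clique-shape {X} X-clique with any? (λ v → (v ∈? X) ×-dec InS? v)
  ... | no X∩S-empty = inj₁ λ {u} u∈X → ∈K⁺ (λ chosen → X∩S-empty (u , u∈X , chosen))
  ... | yes (_ , ℓi∈X , (i , refl)) = inj₂ (i , X⊆Ci)
    where
    X⊆Ci : X ⊆ C i
    X⊆Ci {u} u∈X with u ≟ᶠ ℓ i
    ... | yes refl = proj₁ (loyal i)
    ... | no u≢ℓi with X-clique u (ℓ i) u∈X ℓi∈X u≢ℓi
    ...   | _ , inj₁ (j , u∈Cj , ℓi∈Cj) = subst (λ k → u ∈ C k) (loyal-member ℓi∈Cj) u∈Cj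
    ...   | _ , inj₂ (_ , ℓi∉S) = contradiction (i , refl) ℓi∉S

  clique-size : ¬ UnbalancedCover C → ∀ {X} → IsClique G X → ∣ X ∣ ≤ ∣ K ∣
  clique-size balanced-cover X-clique with clique-shape X-clique
  ... | inj₁ X⊆K = p⊆q⇒∣p∣≤∣q∣ X⊆K
  ... | inj₂ (i , X⊆Ci) = ≤-trans (p⊆q⇒∣p∣≤∣q∣ X⊆Ci) (s≤s⁻¹ (≤∧≢⇒< (member-size i) not-extremal))
    where
    not-extremal : ∣ C i ∣ ≢ suc ∣ K ∣
    not-extremal ∣Ci∣≡1+∣K∣ =
      balanced-cover (i , trans ∣Ci∣≡1+∣K∣ (trans (+-comm 1 ∣ K ∣) (cong (_+ 1) ∣K∣≡n∸m)))

  balanced : ¬ UnbalancedCover C → BalancedSplit G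
  balanced balanced-cover =
    K , (K-clique , S-stable) ,
    ((K , K-clique , refl) , λ _ → clique-size balanced-cover) ,
    ((S , S-stable , refl) , λ _ X-stable → subst (_ ≤_) (sym ∣S∣≡m) (stable-size X-stable))

  -- A member of size n ∸ m + 1 and the stable set S have n + 1 vertices together.
  unbalanced : UnbalancedCover C → ¬ BalancedSplit G
  unbalanced (i , ∣Ci∣≡n∸m+1) G-balanced = 1+n≰n (begin
    suc n                ≡⟨ cong suc (sym (m∸n+n≡m m≤n)) ⟩
    suc (n ∸ m + m)      ≡⟨ sym (+-suc (n ∸ m) m) ⟩
    n ∸ m + suc m        ≡⟨ sym (+-assoc (n ∸ m) 1 m) ⟩
    n ∸ m + 1 + m        ≡⟨ sym (cong₂ _+_ ∣Ci∣≡n∸m+1 ∣S∣≡m) ⟩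
    ∣ C i ∣ + ∣ S ∣      ≤⟨ balanced⇒∣X∣+∣Y∣≤n G-balanced (member-clique i) S-stable ⟩
    n                    ∎)
    where open ≤-Reasoning

theorem2p7 : (n m : ℕ) (C : Family n m) → IsMinimalSetCover C →
    (ℓ : Fin m → Fin n) → (∀ (i : Fin m) → IsLoyal C i (ℓ i)) →
    IsSplitGraph (coverGraph C ℓ) ×
    (UnbalancedSplit (coverGraph C ℓ) ⇔ UnbalancedCover C)
theorem2p7 n m C (cover , _) ℓ loyal = split , mk⇔ unbalancedSplit⇒ unbalancedCover⇒
  where
  open CoverGraph C cover ℓ loyal

  split : IsSplitGraph G
  split = K , K-clique , S-stable

  -- "some member has size n ∸ m + 1" is decidable, and its failure makes G balanced
  unbalancedSplit⇒ : UnbalancedSplit G → UnbalancedCover C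
  unbalancedSplit⇒ (_ , ¬balanced) =
    decidable-stable (any? (λ i → ∣ C i ∣ ≟ n ∸ m + 1)) (¬balanced ∘ balanced)

  unbalancedCover⇒ : UnbalancedCover C → UnbalancedSplit G
  unbalancedCover⇒ unbalanced-cover = split , unbalanced unbalanced-cover
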